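{- Let $G$ be a digraph and $\mathcal{P}=\{V_{ij}:i,j \in [2]\}$ a partition of $V(G)$ with $|V_{12}|=|V_{21}|>0$. Suppose that for every $i \in [2]$ and every proper $i$-pair $\phi^i$ with respect to $\mathcal{P}$, the digraph $\mathcal{J}^{i}(\mathcal{P},G,\phi^i)$ has a Hamilton cycle. Then $G$ has a Hamilton cycle.
   Context: A digraph is a finite directed graph with at most one edge from $a$ to $b$ for each ordered pair; $G$ has no loops. Write $V_{i*}=V_{i1}\cup V_{i2}$, $V_{*i}=V_{1i}\cup V_{2i}$, and let $t=|V_{12}|=|V_{21}|$, with $[t]=\{1,\dots,t\}$ taken disjoint from $V(G)$. For $i\in[2]$, a proper $i$-pair with respect to $\mathcal{P}$ is a pair $\phi^i=(\phi_{i*},\phi_{*i})$ of bijections $\phi_{i*}:[t]\cup V_{ii}\to V_{i*}$ and $\phi_{*i}:[t]\cup V_{ii}\to V_{*i}$ with $\phi_{i*}(x)=\phi_{*i}(x)=x$ for all $x\in V_{ii}$. The digraph $\mathcal{J}^{i}(\mathcal{P},G,\phi^i)$ has vertex set $[t]\cup V_{ii}$ and, for $a,b$ in this set, an edge $ab$ (possibly a loop when $a=b$) if and only if $\phi_{i*}(a)\phi_{*i}(b)\in E(G)$. A Hamilton cycle is a directed cycle through all vertices. -}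

module Defs where

open import Data.Nat using (ℕ; zero; suc; _<_; _<?_)
open import Data.Fin using (Fin; zero; suc; toℕ; fromℕ<)
open import Data.Product using (Σ; _×_; _,_; proj₁; proj₂)
open import Data.Sum using (_⊎_; inj₁; inj₂)
open import Relation.Nullary using (¬_; yes; no)
open import Relation.Binary.PropositionalEquality using (_≡_)
open import Function.Bundles using (_⤖_; Bijection)

-- A digraph on vertex set Fin n: an edge relation without loops.
-- (At most one edge per ordered pair is automatic for a relation.)
record Digraph (n : ℕ) : Set₁ where
  field
    E        : Fin n → Fin n → Set
    loopless : ∀ v → ¬ E v v
open Digraph public

csuc : ∀ {m} → Fin (suc m) → Fin (suc m)
csuc {m} k with suc (toℕ k) <? suc m
... | yes p = fromℕ< p
... | no _  = zero

-- A Hamilton cycle in a (possibly looped) digraph on a vertex type V with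
-- edge relation R: a cyclic ordering v₀,…,v_m of all vertices, each exactly
-- once (a bijection Fin (suc m) ⤖ V), with edges v_k v_{k+1} and v_m v₀.
-- (For m = 0 this is a loop.)
record HamiltonCycle {V : Set} (R : V → V → Set) : Set where
  field
    m     : ℕ
    order : Fin (suc m) ⤖ V
    edges : ∀ k → R (Bijection.to order k) (Bijection.to order (csuc k))

-- A partition P = {V_ij : i,j ∈ [2]} of Fin n, given by labels
-- (index zero stands for 1, suc zero for 2).
Partition : ℕ → Set
Partition n = Fin n → Fin 2 × Fin 2

module _ {n : ℕ} (P : Partition n) where
  Part : Fin 2 → Fin 2 → Set
  Part i j = Σ (Fin n) λ v → P v ≡ (i , j)
  Row : Fin 2 → Set
  Row i = Σ (Fin n) λ v → proj₁ (P v) ≡ i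
  Col : Fin 2 → Set
  Col i = Σ (Fin n) λ v → proj₂ (P v) ≡ i

  -- vertex set [t] ∪ V_ii of J^i (with [t] disjoint from V(G))
  JVert : ℕ → Fin 2 → Set
  JVert t i = Fin t ⊎ Part i i

  record ProperPair (t : ℕ) (i : Fin 2) : Set where
    field
      φrow : JVert t i ⤖ Row i
      φcol : JVert t i ⤖ Col i
      φrow-fix : ∀ (x : Part i i) → proj₁ (Bijection.to φrow (inj₂ x)) ≡ proj₁ x
      φcol-fix : ∀ (x : Part i i) → proj₁ (Bijection.to φcol (inj₂ x)) ≡ proj₁ x

  JEdge : (G : Digraph n) {t : ℕ} {i : Fin 2} → ProperPair t i →
          JVert t i → JVert t i → Set
  JEdge G φ a b =
    E G (proj₁ (Bijection.to (ProperPair.φrow φ) a))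
        (proj₁ (Bijection.to (ProperPair.φcol φ) b))

module Submission where

-- Follow H₁, a Hamilton cycle of J¹ for the pair φ_{1*}(k) = α⁻¹ k, φ_{*1}(k) = β⁻¹ k: leaving
-- [t] at k it runs through V₁₁ and re-enters [t] at some c k, and the first-return map c is a
-- permutation of [t].  Twist the second pair by it, φ_{2*}(k) = β⁻¹ (c k), φ_{*2}(k) = α⁻¹ k,
-- and take a Hamilton cycle H₂ of J².  Reading both cycles in G (a vertex in row i is sent along
-- H_i to a vertex in column i) gives a successor map s on V(G): it is injective, follows edges,
-- and from α⁻¹ k it runs through V₁₁ to β⁻¹ (c k) = φ_{2*}(k) and then along H₂.  So the orbit of
-- one vertex of V₁₂ follows all of H₂, hence meets all of V₁₂ and then all of H₁: s is a single
-- cycle through V(G).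

open import Defs
open import Data.Nat using (ℕ; zero; suc; _+_; _*_; _∸_; _<_; _≤_; _<?_; s≤s; s≤s⁻¹; s<s⁻¹)
open import Data.Nat.Properties
  using (≤-refl; ≤-antisym; ≤-total; <⇒≤; <-≤-trans; ≮⇒≥; n<1+n; <-cmp; 1+n≰n; <-irrefl;
         +-comm; +-suc; m≤n+m; m∸n+n≡m; m≤n⇒∃[o]m+o≡n; m<1+n⇒m<n∨m≡n)
open import Data.Nat.DivMod using (_%_; _/_; m≡m%n+[m/n]*n; m%n<n)
open import Data.Nat.GeneralisedArithmetic using (fold; fold-+)
open import Data.Fin using (Fin; zero; suc; toℕ; fromℕ<; opposite; punchOut)
open import Data.Fin.Properties
  using (toℕ-fromℕ<; toℕ-injective; toℕ<n; pigeonhole; any?; punchOut-injective; injective⇒≤)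
  renaming (_≟_ to _≟ᶠ_)
open import Data.Product using (∃; _×_; _,_; proj₁; proj₂; uncurry; swap)
open import Data.Sum using (_⊎_; inj₁; inj₂; [_,_]′)
open import Data.Sum.Properties using (inj₁-injective)
open import Function.Base using (_∘_)
open import Function.Bundles using (_⤖_; _↔_; Bijection; Inverse; Injection; mk⤖; mk↔ₛ′)
open import Function.Consequences.Propositional using (strictlySurjective⇒surjective)
open import Function.Construct.Composition using (_↔-∘_)
open import Function.Construct.Identity using (↔-id)
open import Function.Construct.Symmetry using (↔-sym)
open import Function.Properties.Bijection using (⤖⇒↔)
open import Function.Properties.Inverse using (↔⇒⤖; ↔⇒↣)
open import Function.Related.TypeIsomorphisms using (Σ-distribˡ-⊎)
open import Data.Sum.Function.Propositional using (_⊎-↔_)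
import Data.Product.Function.Dependent.Propositional as Σ
open import Relation.Binary using (tri<; tri≈; tri>)
open import Relation.Nullary using (¬_; Dec; yes; no; contradiction)
open import Relation.Binary.PropositionalEquality
open ≡-Reasoning

-- Iterates and reachability

Reach : {A : Set} → (A → A) → A → A → Set
Reach f x y = ∃ λ k → fold x f k ≡ y

module _ {A : Set} (f : A → A) where

  fold-suc′ : ∀ x k → fold x f (suc k) ≡ fold (f x) f k
  fold-suc′ x k = trans (cong (fold x f) (+-comm 1 k)) (fold-+ x f k)

  Reach-step : ∀ {x y} → Reach f x y → Reach f x (f y)
  Reach-step (k , e) = suc k , cong f e

  Reach-trans : ∀ {x y z} → Reach f x y → Reach f y z → Reach f x z
  Reach-trans {x} (k , refl) (l , refl) = l + k , fold-+ x f l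

  Reach-induction : (Q : A → Set) → (∀ x → Q x → Q (f x)) → ∀ {x y} → Reach f x y → Q x → Q y
  Reach-induction Q step (zero , refl) q = q
  Reach-induction Q step (suc k , refl) q = step _ (Reach-induction Q step (k , refl) q)

  module _ {x : A} {q : ℕ} (period : fold x f (suc q) ≡ x) where

    fold-multiple : ∀ c → fold x f (c * suc q) ≡ x
    fold-multiple zero = refl
    fold-multiple (suc c) = begin
      fold x f (suc q + c * suc q)           ≡⟨ fold-+ x f (suc q) ⟩
      fold (fold x f (c * suc q)) f (suc q)  ≡⟨ cong (λ y → fold y f (suc q)) (fold-multiple c) ⟩
      fold x f (suc q)                       ≡⟨ period ⟩
      x                                      ∎

    fold-mod : ∀ k → fold x f (k % suc q) ≡ fold x f k
    fold-mod k = begin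
      fold x f (k % suc q)
        ≡⟨ cong (λ y → fold y f (k % suc q)) (sym (fold-multiple (k / suc q))) ⟩
      fold (fold x f (k / suc q * suc q)) f (k % suc q)
        ≡⟨ sym (fold-+ x f (k % suc q)) ⟩
      fold x f (k % suc q + k / suc q * suc q)
        ≡⟨ cong (fold x f) (sym (m≡m%n+[m/n]*n k (suc q))) ⟩
      fold x f k
        ∎

  fold-period-shift : ∀ {x N} → fold x f N ≡ x → ∀ j → fold (fold x f j) f N ≡ fold x f j
  fold-period-shift {x} {N} period j = begin
    fold (fold x f j) f N  ≡⟨ sym (fold-+ x f N) ⟩
    fold x f (N + j)       ≡⟨ cong (fold x f) (+-comm N j) ⟩
    fold x f (j + N)       ≡⟨ fold-+ x f j ⟩
    fold (fold x f N) f j  ≡⟨ cong (λ y → fold y f j) period ⟩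
    fold x f j             ∎

  periodic⇒injective : ∀ m → (∀ x → fold x f (suc m) ≡ x) → ∀ {x y} → f x ≡ f y → x ≡ y
  periodic⇒injective m period {x} {y} e = begin
    x                 ≡⟨ sym (period x) ⟩
    fold x f (suc m)  ≡⟨ fold-suc′ x m ⟩
    fold (f x) f m    ≡⟨ cong (λ z → fold z f m) e ⟩
    fold (f y) f m    ≡⟨ sym (fold-suc′ y m) ⟩
    fold y f (suc m)  ≡⟨ period y ⟩
    y                 ∎

  module _ (f-injective : ∀ {x y} → f x ≡ f y → x ≡ y) where

    fold-injective : ∀ k {x y} → fold x f k ≡ fold y f k → x ≡ y
    fold-injective zero e = e
    fold-injective (suc k) e = fold-injective k (f-injective e)

    fold-cancel : ∀ x i d → fold x f (i + d) ≡ fold x f i → fold x f d ≡ x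
    fold-cancel x i d e = fold-injective i (trans (sym (fold-+ x f i)) e)

    fold-repeat⇒return : ∀ {x i j} → i < j → fold x f i ≡ fold x f j →
                         ∃ λ r → r < j × fold x f (suc r) ≡ x
    fold-repeat⇒return {x} {i} {j} i<j e with m≤n⇒∃[o]m+o≡n i<j
    ... | r , refl = r , s≤s (m≤n+m r i) , fold-cancel x i (suc r) (begin
      fold x f (i + suc r)  ≡⟨ cong (fold x f) (+-suc i r) ⟩
      fold x f (suc i + r)  ≡⟨ sym e ⟩
      fold x f i            ∎)

fold-conjugate : ∀ {A B : Set} (e : A ↔ B) (f : A → A) x k →
                 fold (Inverse.to e x) (Inverse.to e ∘ f ∘ Inverse.from e) k ≡ Inverse.to e (fold x f k)
fold-conjugate e f x zero = refl
fold-conjugate e f x (suc k) =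
  cong (Inverse.to e ∘ f) (trans (cong (Inverse.from e) (fold-conjugate e f x k))
                                 (Inverse.strictlyInverseʳ e (fold x f k)))

Least : (ℕ → Set) → ℕ → Set
Least Q q = Q q × (∀ r → r < q → ¬ Q r)

least-or-none-below : ∀ {Q : ℕ → Set} → (∀ r → Dec (Q r)) → ∀ n →
                      ∃ (Least Q) ⊎ (∀ r → r < n → ¬ Q r)
least-or-none-below Q? zero = inj₂ λ r ()
least-or-none-below Q? (suc n) with least-or-none-below Q? n | Q? n
... | inj₁ least | _     = inj₁ least
... | inj₂ none  | yes q = inj₁ (n , q , none)
... | inj₂ none  | no ¬q = inj₂ λ r r<1+n → [ none r , (λ { refl → ¬q }) ]′ (m<1+n⇒m<n∨m≡n r<1+n)

least-witness : ∀ {Q : ℕ → Set} → (∀ r → Dec (Q r)) → ∃ Q → ∃ (Least Q)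
least-witness Q? (b , q) with least-or-none-below Q? (suc b)
... | inj₁ least = least
... | inj₂ none  = contradiction q (none b (n<1+n b))

injective⇒surjective : ∀ {t} (f : Fin t → Fin t) → (∀ {x y} → f x ≡ f y → x ≡ y) →
                       ∀ y → ∃ λ x → f x ≡ y
injective⇒surjective {suc t} f f-injective y with any? (λ x → f x ≟ᶠ y)
... | yes hit = hit
... | no miss = contradiction (injective⇒≤ punchOut-f-injective) 1+n≰n
  where
  y≢f : ∀ x → ¬ y ≡ f x
  y≢f x e = miss (x , sym e)
  punchOut-f-injective : ∀ {x x′} → punchOut (y≢f x) ≡ punchOut (y≢f x′) → x ≡ x′
  punchOut-f-injective e = f-injective (punchOut-injective (y≢f _) (y≢f _) e)

injective⇒↔ : ∀ {t} (f : Fin t → Fin t) → (∀ {x y} → f x ≡ f y → x ≡ y) → Fin t ↔ Fin t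
injective⇒↔ f f-injective =
  ⤖⇒↔ (mk⤖ (f-injective , strictlySurjective⇒surjective (injective⇒surjective f f-injective)))

-- Hamilton cycles as cyclic successor maps

module _ {m : ℕ} where

  toℕ-csuc : ∀ (k : Fin (suc m)) →
             (toℕ k < m × toℕ (csuc k) ≡ suc (toℕ k)) ⊎ (toℕ k ≡ m × csuc k ≡ zero)
  toℕ-csuc k with suc (toℕ k) <? suc m
  ... | yes k<m = inj₁ (s<s⁻¹ k<m , toℕ-fromℕ< k<m)
  ... | no  k≮m = inj₂ (≤-antisym (s≤s⁻¹ (toℕ<n k)) (≮⇒≥ (k≮m ∘ s≤s)) , refl)

  toℕ-fold-csuc : ∀ j → j ≤ m → toℕ (fold zero (csuc {m}) j) ≡ j
  toℕ-fold-csuc zero _ = refl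
  toℕ-fold-csuc (suc j) j<m with toℕ-fold-csuc j (<⇒≤ j<m) | toℕ-csuc (fold zero csuc j)
  ... | IH | inj₁ (_ , e)  = trans e (cong suc IH)
  ... | IH | inj₂ (e , _)  = contradiction (trans (sym IH) e) (λ j≡m → <-irrefl j≡m j<m)

  fold-csuc-toℕ : ∀ (p : Fin (suc m)) → fold zero csuc (toℕ p) ≡ p
  fold-csuc-toℕ p = toℕ-injective (toℕ-fold-csuc (toℕ p) (s≤s⁻¹ (toℕ<n p)))

  fold-csuc-length : fold zero (csuc {m}) (suc m) ≡ zero
  fold-csuc-length with toℕ-csuc (fold zero csuc m) | toℕ-fold-csuc m ≤-refl
  ... | inj₁ (m<m , _) | e = contradiction (subst (_< m) e m<m) (<-irrefl refl)
  ... | inj₂ (_ , e)   | _ = e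

  csuc-periodic : ∀ (p : Fin (suc m)) → fold p csuc (suc m) ≡ p
  csuc-periodic p = subst (λ q → fold q csuc (suc m) ≡ q) (fold-csuc-toℕ p)
                          (fold-period-shift csuc {N = suc m} fold-csuc-length (toℕ p))

  csuc-reach : ∀ (p q : Fin (suc m)) → Reach csuc p q
  csuc-reach p q = Reach-trans csuc (suc m ∸ toℕ p , to-zero) (toℕ q , fold-csuc-toℕ q)
    where
    to-zero : fold p csuc (suc m ∸ toℕ p) ≡ zero
    to-zero = begin
      fold p csuc (suc m ∸ toℕ p)
        ≡⟨ cong (λ q → fold q csuc (suc m ∸ toℕ p)) (sym (fold-csuc-toℕ p)) ⟩
      fold (fold zero csuc (toℕ p)) csuc (suc m ∸ toℕ p)
        ≡⟨ sym (fold-+ zero csuc (suc m ∸ toℕ p)) ⟩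
      fold zero csuc (suc m ∸ toℕ p + toℕ p)
        ≡⟨ cong (fold zero csuc) (m∸n+n≡m (<⇒≤ (toℕ<n p))) ⟩
      fold zero csuc (suc m)
        ≡⟨ fold-csuc-length ⟩
      zero
        ∎

module HamiltonCycleSuccessor {V : Set} {R : V → V → Set} (H : HamiltonCycle R) where
  open HamiltonCycle H using (order; edges)
  open HamiltonCycle H public using (m)
  private
    open module O = Inverse (⤖⇒↔ order) using (to; from)

  next : V → V
  next = to ∘ csuc ∘ from

  next-edge : ∀ v → R v (next v)
  next-edge v = subst (λ w → R w (next v)) (O.strictlyInverseˡ v) (edges (from v))

  next-reach : ∀ v w → Reach next v w
  next-reach v w with csuc-reach (from v) (from w)
  ... | k , e = k , (begin
    fold v next k                ≡⟨ cong (λ u → fold u next k) (sym (O.strictlyInverseˡ v)) ⟩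
    fold (to (from v)) next k    ≡⟨ fold-conjugate (⤖⇒↔ order) csuc (from v) k ⟩
    to (fold (from v) csuc k)    ≡⟨ cong to e ⟩
    to (from w)                  ≡⟨ O.strictlyInverseˡ w ⟩
    w                            ∎)

  next-periodic : ∀ v → fold v next (suc m) ≡ v
  next-periodic v = begin
    fold v next (suc m)                ≡⟨ cong (λ u → fold u next (suc m)) (sym (O.strictlyInverseˡ v)) ⟩
    fold (to (from v)) next (suc m)    ≡⟨ fold-conjugate (⤖⇒↔ order) csuc (from v) (suc m) ⟩
    to (fold (from v) csuc (suc m))    ≡⟨ cong to (csuc-periodic (from v)) ⟩
    to (from v)                        ≡⟨ O.strictlyInverseˡ v ⟩
    v                                  ∎

  next-injective : ∀ {v w} → next v ≡ next w → v ≡ w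
  next-injective = periodic⇒injective next m next-periodic

  next-induction : (Q : V → Set) → (∀ v → Q v → Q (next v)) → ∀ v₀ → Q v₀ → ∀ v → Q v
  next-induction Q step v₀ q v = Reach-induction next Q step (next-reach v₀ v) q

module _ {n : ℕ} {R : Fin n → Fin n → Set} (s : Fin n → Fin n) (s-edge : ∀ v → R v (s v))
         (s-injective : ∀ {v w} → s v ≡ s w → v ≡ w) (v₀ : Fin n) where

  Returns : ℕ → Set
  Returns r = fold v₀ s (suc r) ≡ v₀

  orbit⇒HamiltonCycle : (∀ v → Reach s v₀ v) → ∀ q → Least Returns q → HamiltonCycle R
  orbit⇒HamiltonCycle reach q (period , minimal) = record
    { m     = q
    ; order = mk⤖ (orbit-injective , orbit-surjective)
    ; edges = λ k → subst (R (orbit k)) (sym (orbit-csuc k)) (s-edge (orbit k))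
    }
    where
    orbit : Fin (suc q) → Fin n
    orbit i = fold v₀ s (toℕ i)

    no-early-repeat : ∀ {i j} → i < j → j < suc q → ¬ fold v₀ s i ≡ fold v₀ s j
    no-early-repeat i<j j≤q e with fold-repeat⇒return s s-injective i<j e
    ... | r , r<j , e′ = minimal r (<-≤-trans r<j (s≤s⁻¹ j≤q)) e′

    orbit-injective : ∀ {i j} → orbit i ≡ orbit j → i ≡ j
    orbit-injective {i} {j} e with <-cmp (toℕ i) (toℕ j)
    ... | tri< i<j _ _ = contradiction e (no-early-repeat i<j (toℕ<n j))
    ... | tri≈ _ i≡j _ = toℕ-injective i≡j
    ... | tri> _ _ j<i = contradiction (sym e) (no-early-repeat j<i (toℕ<n i))

    orbit-surjective : ∀ v → ∃ λ i → ∀ {j} → j ≡ i → orbit j ≡ v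
    orbit-surjective v with reach v
    ... | k , e = fromℕ< (m%n<n k (suc q)) , λ { refl →
      trans (cong (fold v₀ s) (toℕ-fromℕ< (m%n<n k (suc q)))) (trans (fold-mod s period k) e) }

    orbit-csuc : ∀ k → orbit (csuc k) ≡ s (orbit k)
    orbit-csuc k with toℕ-csuc k
    ... | inj₁ (_ , e)  = cong (fold v₀ s) e
    ... | inj₂ (e , e′) = trans (cong orbit e′) (trans (sym period) (cong (s ∘ fold v₀ s) (sym e)))

  eventually-returns : ∃ Returns
  eventually-returns with pigeonhole (n<1+n n) (λ (i : Fin (suc n)) → fold v₀ s (toℕ i))
  ... | i , j , i<j , e with fold-repeat⇒return s s-injective i<j e
  ...   | r , _ , e′ = r , e′

  cyclicSuccessor⇒HamiltonCycle : (∀ v → Reach s v₀ v) → HamiltonCycle R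
  cyclicSuccessor⇒HamiltonCycle reach = uncurry (orbit⇒HamiltonCycle reach)
    (least-witness (λ r → fold v₀ s (suc r) ≟ᶠ v₀) eventually-returns)

-- First returns to the left summand

module FirstReturn {A B : Set} (f : A ⊎ B → A ⊎ B) (f-injective : ∀ {x y} → f x ≡ f y → x ≡ y)
  (returns : ∀ a → ∃ λ d → fold (inj₁ a) f (suc d) ≡ inj₁ a) where

  ReturnsAt : A → ℕ → Set
  ReturnsAt a d = ∃ λ a′ → fold (inj₁ a) f (suc d) ≡ inj₁ a′

  returnsAt? : ∀ a d → Dec (ReturnsAt a d)
  returnsAt? a d with fold (inj₁ a) f (suc d)
  ... | inj₁ a′ = yes (a′ , refl)
  ... | inj₂ _  = no λ { (_ , ()) }

  earliestReturn : ∀ a → ∃ (Least (ReturnsAt a))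
  earliestReturn a = least-witness (returnsAt? a) (proj₁ (returns a) , a , proj₂ (returns a))

  returnTime : A → ℕ
  returnTime a = proj₁ (earliestReturn a)

  firstReturn : A → A
  firstReturn a = proj₁ (proj₁ (proj₂ (earliestReturn a)))

  fold-returnTime : ∀ a → fold (inj₁ a) f (suc (returnTime a)) ≡ inj₁ (firstReturn a)
  fold-returnTime a = proj₂ (proj₁ (proj₂ (earliestReturn a)))

  no-earlier-return : ∀ a e → e < returnTime a → ¬ ReturnsAt a e
  no-earlier-return a = proj₂ (proj₂ (earliestReturn a))

  firstReturn-induction : (Q : A ⊎ B → Set) → (∀ b → Q (inj₂ b) → Q (f (inj₂ b))) →
                          ∀ a → Q (f (inj₁ a)) → Q (inj₁ (firstReturn a))
  firstReturn-induction Q step a q = subst Q (fold-returnTime a) (along (returnTime a) ≤-refl)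
    where
    through : ∀ x → ¬ (∃ λ a′ → x ≡ inj₁ a′) → Q x → Q (f x)
    through (inj₁ a′) ¬ret _ = contradiction (a′ , refl) ¬ret
    through (inj₂ b)  _    q = step b q
    along : ∀ e → e ≤ returnTime a → Q (fold (inj₁ a) f (suc e))
    along zero    _   = q
    along (suc e) e<d = through _ (no-earlier-return a e e<d) (along e (<⇒≤ e<d))

  -- Cancelling the last returnTime a + 1 steps leaves a return of a′ to a after δ steps, and δ
  -- would be an earlier return time of a′ unless δ = 0.
  same-return⇒≡ : ∀ {a a′} → returnTime a ≤ returnTime a′ → firstReturn a ≡ firstReturn a′ → a ≡ a′
  same-return⇒≡ {a} {a′} d≤d′ e with m≤n⇒∃[o]m+o≡n d≤d′
  ... | δ , d+δ≡d′ = cancelled δ (subst (δ ≤_) d+δ≡d′ (m≤n+m δ d)) (fold-injective f f-injective (suc d) (begin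
    fold (inj₁ a) f (suc d)               ≡⟨ fold-returnTime a ⟩
    inj₁ (firstReturn a)                  ≡⟨ cong inj₁ e ⟩
    inj₁ (firstReturn a′)                 ≡⟨ sym (fold-returnTime a′) ⟩
    fold (inj₁ a′) f (suc d′)             ≡⟨ cong (λ k → fold (inj₁ a′) f (suc k)) (sym d+δ≡d′) ⟩
    fold (inj₁ a′) f (suc d + δ)          ≡⟨ fold-+ (inj₁ a′) f (suc d) ⟩
    fold (fold (inj₁ a′) f δ) f (suc d)   ∎))
    where
    d = returnTime a
    d′ = returnTime a′
    cancelled : ∀ δ → δ ≤ d′ → inj₁ a ≡ fold (inj₁ a′) f δ → a ≡ a′
    cancelled zero    _     e = inj₁-injective e
    cancelled (suc ε) ε<d′ e = contradiction (a , sym e) (no-earlier-return a′ ε ε<d′)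

  firstReturn-injective : ∀ {a a′} → firstReturn a ≡ firstReturn a′ → a ≡ a′
  firstReturn-injective {a} {a′} e with ≤-total (returnTime a) (returnTime a′)
  ... | inj₁ d≤d′ = same-return⇒≡ d≤d′ e
  ... | inj₂ d′≤d = sym (same-return⇒≡ d′≤d (sym e))

proj₁≡↔ : ∀ (p : Fin 2 × Fin 2) i → (proj₁ p ≡ i) ↔ (p ≡ (i , opposite i) ⊎ p ≡ (i , i))
proj₁≡↔ p i = mk↔ₛ′ to from to∘from from∘to
  where
  to : ∀ {p : Fin 2 × Fin 2} {i : Fin 2} → proj₁ p ≡ i → p ≡ (i , opposite i) ⊎ p ≡ (i , i)
  to {zero     , zero}     refl = inj₂ refl
  to {zero     , suc zero} refl = inj₁ refl
  to {suc zero , zero}     refl = inj₁ refl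
  to {suc zero , suc zero} refl = inj₂ refl
  from : ∀ {p : Fin 2 × Fin 2} {i : Fin 2} → p ≡ (i , opposite i) ⊎ p ≡ (i , i) → proj₁ p ≡ i
  from (inj₁ refl) = refl
  from (inj₂ refl) = refl
  to∘from : ∀ {p : Fin 2 × Fin 2} {i : Fin 2} (e : p ≡ (i , opposite i) ⊎ p ≡ (i , i)) → to {p} {i} (from e) ≡ e
  to∘from {i = zero}     (inj₁ refl) = refl
  to∘from {i = suc zero} (inj₁ refl) = refl
  to∘from {i = zero}     (inj₂ refl) = refl
  to∘from {i = suc zero} (inj₂ refl) = refl
  from∘to : ∀ {p : Fin 2 × Fin 2} {i : Fin 2} (e : proj₁ p ≡ i) → from {p} {i} (to e) ≡ e
  from∘to {zero     , zero}     refl = refl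
  from∘to {zero     , suc zero} refl = refl
  from∘to {suc zero , zero}     refl = refl
  from∘to {suc zero , suc zero} refl = refl

swap≡↔ : ∀ {A B : Set} {p : A × B} {a b} → (swap p ≡ (a , b)) ↔ (p ≡ (b , a))
swap≡↔ = mk↔ₛ′ (λ { refl → refl }) (λ { refl → refl }) (λ { refl → refl }) (λ { refl → refl })

proj₂≡↔ : ∀ (p : Fin 2 × Fin 2) i → (proj₂ p ≡ i) ↔ (p ≡ (opposite i , i) ⊎ p ≡ (i , i))
proj₂≡↔ p i = (swap≡↔ ⊎-↔ swap≡↔) ↔-∘ proj₁≡↔ (swap p) i

module _ {n : ℕ} (P : Partition n) where

  Row↔Parts : ∀ i → Row P i ↔ (Part P i (opposite i) ⊎ Part P i i)
  Row↔Parts i = Σ-distribˡ-⊎ ↔-∘ Σ.congˡ (λ {v} → proj₁≡↔ (P v) i)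

  Col↔Parts : ∀ i → Col P i ↔ (Part P (opposite i) i ⊎ Part P i i)
  Col↔Parts i = Σ-distribˡ-⊎ ↔-∘ Σ.congˡ (λ {v} → proj₂≡↔ (P v) i)

  properPair : ∀ {t} i → (Fin t ↔ Part P i (opposite i)) → (Fin t ↔ Part P (opposite i) i) →
               ProperPair P t i
  properPair i g h = record
    { φrow     = ↔⇒⤖ (↔-sym (Row↔Parts i) ↔-∘ (g ⊎-↔ ↔-id _))
    ; φcol     = ↔⇒⤖ (↔-sym (Col↔Parts i) ↔-∘ (h ⊎-↔ ↔-id _))
    ; φrow-fix = λ _ → refl
    ; φcol-fix = λ _ → refl
    }

-- Gluing Hamilton cycles of J¹ and J² into a successor map on V(G)

module Gluing {n : ℕ} (G : Digraph n) (P : Partition n) {t : ℕ}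
  (π : ∀ i → ProperPair P t i) (H : ∀ i → HamiltonCycle (JEdge P G (π i))) where

  module Hᵢ (i : Fin 2) = HamiltonCycleSuccessor (H i)
  open Hᵢ using (next; next-edge; next-injective; next-induction)

  φrow : ∀ i → JVert P t i ↔ Row P i
  φrow i = ⤖⇒↔ (ProperPair.φrow (π i))

  φcol : ∀ i → JVert P t i ↔ Col P i
  φcol i = ⤖⇒↔ (ProperPair.φcol (π i))

  row col : ∀ i → JVert P t i → Fin n
  row i = proj₁ ∘ Inverse.to (φrow i)
  col i = proj₁ ∘ Inverse.to (φcol i)

  σ : ∀ i → Row P i → Col P i
  σ i = Inverse.to (φcol i) ∘ next i ∘ Inverse.from (φrow i)

  s : Fin n → Fin n
  s v = proj₁ (σ (proj₁ (P v)) (v , refl))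

  s-fiber : ∀ i (r : Row P i) → s (proj₁ r) ≡ proj₁ (σ i r)
  s-fiber i (v , refl) = refl

  s-row : ∀ i a → s (row i a) ≡ col i (next i a)
  s-row i a = trans (s-fiber i (Inverse.to (φrow i) a))
                    (cong (col i ∘ next i) (Inverse.strictlyInverseʳ (φrow i) a))

  s-edge : ∀ v → E G v (s v)
  s-edge v = subst (λ w → E G w (s v)) (cong proj₁ (Inverse.strictlyInverseˡ (φrow i) (v , refl)))
                   (next-edge i (Inverse.from (φrow i) (v , refl)))
    where
    i = proj₁ (P v)

  σ-injective : ∀ i {r r′} → σ i r ≡ σ i r′ → r ≡ r′
  σ-injective i = from-injective ∘ next-injective i ∘ Bijection.injective (ProperPair.φcol (π i))
    where
    from-injective = Injection.injective (↔⇒↣ (↔-sym (φrow i)))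

  Col-≡ : ∀ {i} {c c′ : Col P i} → proj₁ c ≡ proj₁ c′ → c ≡ c′
  Col-≡ {c = v , refl} {c′ = .v , refl} refl = refl

  s-injective : ∀ {v w} → s v ≡ s w → v ≡ w
  s-injective {v} {w} e =
    cong proj₁ (σ-injective (proj₁ (P v)) (Col-≡ (trans e (s-fiber _ (w , sym same-row)))))
    where
    same-row : proj₁ (P v) ≡ proj₁ (P w)
    same-row = trans (sym (proj₂ (σ _ (v , refl)))) (trans (cong (proj₂ ∘ P) e) (proj₂ (σ _ (w , refl))))

  module Propagation (Q : Fin n → Set) (Q-step : ∀ v → Q v → Q (s v)) where

    along-cycle : ∀ i a → Q (row i a) → Q (col i (next i a))
    along-cycle i a = subst Q (s-row i a) ∘ Q-step (row i a)

    col-induction : ∀ i → (∀ k → Q (col i (inj₁ k)) → Q (row i (inj₁ k))) →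
                    ∀ b₀ → Q (col i b₀) → ∀ b → Q (col i b)
    col-induction i bridge = next-induction i (Q ∘ col i) (λ b → along-cycle i b ∘ col⇒row b)
      where
      col⇒row : ∀ b → Q (col i b) → Q (row i b)
      col⇒row (inj₁ k) = bridge k
      col⇒row (inj₂ x) =
        subst Q (trans (ProperPair.φcol-fix (π i) x) (sym (ProperPair.φrow-fix (π i) x)))

module TwistedCycles {n : ℕ} (G : Digraph n) (P : Partition n) {t : ℕ} (k₀ : Fin t)
  (α : Part P zero (suc zero) ⤖ Fin t) (β : Part P (suc zero) zero ⤖ Fin t)
  (ham : ∀ i (φ : ProperPair P t i) → HamiltonCycle (JEdge P G φ)) where

  α⁻¹ : Fin t ↔ Part P zero (suc zero)
  α⁻¹ = ↔-sym (⤖⇒↔ α)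

  β⁻¹ : Fin t ↔ Part P (suc zero) zero
  β⁻¹ = ↔-sym (⤖⇒↔ β)

  pair₁ : ProperPair P t zero
  pair₁ = properPair P zero α⁻¹ β⁻¹

  module H₁ = HamiltonCycleSuccessor (ham zero pair₁)
  open FirstReturn H₁.next H₁.next-injective (λ a → H₁.m , H₁.next-periodic (inj₁ a))

  pair₂ : ProperPair P t (suc zero)
  pair₂ = properPair P (suc zero) (β⁻¹ ↔-∘ injective⇒↔ firstReturn firstReturn-injective) α⁻¹

  π : ∀ i → ProperPair P t i
  π zero       = pair₁
  π (suc zero) = pair₂

  open Gluing G P π (λ i → ham i (π i))

  v₀ : Fin n
  v₀ = row zero (inj₁ k₀)

  Reachable : Fin n → Set
  Reachable = Reach s v₀

  open Propagation Reachable (λ _ → Reach-step s)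

  -- From α⁻¹ k the map s runs through V₁₁ along H₁ and arrives at β⁻¹ (firstReturn k).
  through-V₁₁ : ∀ k → Reachable (col (suc zero) (inj₁ k)) → Reachable (row (suc zero) (inj₁ k))
  through-V₁₁ k r = firstReturn-induction (Reachable ∘ col zero) (λ x → along-cycle zero (inj₂ x)) k
                                          (along-cycle zero (inj₁ k) r)

  reach-col₂ : ∀ b → Reachable (col (suc zero) b)
  reach-col₂ = col-induction (suc zero) through-V₁₁ (inj₁ k₀) (0 , refl)

  reach-col₁ : ∀ b → Reachable (col zero b)
  reach-col₁ = col-induction zero (λ k _ → reach-col₂ (inj₁ k))
    (H₁.next (inj₁ k₀)) (along-cycle zero (inj₁ k₀) (0 , refl))

  reach-col : ∀ i b → Reachable (col i b)
  reach-col zero       = reach-col₁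
  reach-col (suc zero) = reach-col₂

  reachable : ∀ v → Reachable v
  reachable v = subst Reachable (cong proj₁ (Inverse.strictlyInverseˡ (φcol i) (v , refl)))
                                (reach-col i (Inverse.from (φcol i) (v , refl)))
    where
    i = proj₂ (P v)

  hamiltonCycle : HamiltonCycle (E G)
  hamiltonCycle = cyclicSuccessor⇒HamiltonCycle s s-edge s-injective v₀ reachable

proposition5p1 : ∀ {n : ℕ} (G : Digraph n) (P : Partition n) (t : ℕ) → 0 < t → (Part P zero (suc zero) ⤖ Fin t) → (Part P (suc zero) zero ⤖ Fin t) → (∀ (i : Fin 2) (φ : ProperPair P t i) → HamiltonCycle (JEdge P G φ)) → HamiltonCycle (E G)
proposition5p1 G P t 0<t α β ham = TwistedCycles.hamiltonCycle G P (fromℕ< 0<t) α β ham
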